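{- (Soundness of axiom C10.) For every causal multiteam $T$ of signature $\sigma$, every $Y\in\mathrm{Dom}$, $y\in\mathrm{Ran}(Y)$ and $\mathbf w\in\mathrm{Ran}(\mathbf W_Y)$, $T\models(\varphi_{End(Y)})^C\to\big(Y=y\supset(\mathbf W_Y=\mathbf w\,\Box\!\!\to Y=y)\big)$.
   Context: Signature $\sigma=(\mathrm{Dom},\mathrm{Ran})$: finite nonempty set $\mathrm{Dom}$ of variables with a fixed ordering, finite nonempty value sets $\mathrm{Ran}(X)$; $\mathbf W_V$ lists $\mathrm{Dom}\setminus\{V\}$ in order and $\mathbf W_{XY}$ lists $\mathrm{Dom}\setminus\{X,Y\}$. An assignment $s$ maps each $X$ to $s(X)\in\mathrm{Ran}(X)$. A multiteam is a finite set of assignments, each extended by an extra variable $Key$ (never mentioned in formulas) with pairwise distinct natural values on distinct elements. A causal multiteam $T=(T^-,\mathcal F)$: a multiteam $T^-$ and, for each $V$ in a set $\mathrm{End}(T)\subseteq\mathrm{Dom}$ of endogenous variables (others exogenous), a non-constant $\mathcal F_V:\mathrm{Ran}(\mathbf W_V)\to\mathrm{Ran}(V)$ with $\mathcal F_V(s(\mathbf W_V))=s(V)$ for all $s\in T^-$; the causal graph (arrow $X\to V$ iff $\mathcal F_V$ depends on $X$; $\mathrm{PA}_V$ the set of such $X$) is acyclic. $\mathbf X=\mathbf x$ abbreviates $X_1=x_1\wedge\dots\wedge X_n=x_n$, inconsistent if some variable gets two distinct values. For consistent $\mathbf X=\mathbf x$, $T_{\mathbf X=\mathbf x}=(\{s'\mid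 s\in T^-\},\mathcal F\upharpoonright(\mathrm{End}(T)\setminus\mathbf X))$ where $s'$ keeps the $Key$ of $s$, $s'(X_i)=x_i$, $s'(V)=s(V)$ for exogenous $V\notin\mathbf X$, $s'(V)=\mathcal F_V(s'(\mathrm{PA}_V))$ recursively for endogenous $V\notin\mathbf X$. Semantics: $T\models Y=y$ iff $s(Y)=y$ for all $s\in T^-$; $T\models\alpha\supset\psi$ iff $T^\alpha\models\psi$, where $T^\alpha=(\{s\in T^-\mid(\{s\},\mathcal F)\models\alpha\},\mathcal F)$; $T\models\mathbf X=\mathbf x\Box\!\!\to\psi$ iff $\mathbf X=\mathbf x$ inconsistent or $T_{\mathbf X=\mathbf x}\models\psi$; $\wedge$ classical; $T\models\psi\sqcup\chi$ iff $T\models\psi$ or $T\models\chi$; $T\models\alpha\vee\beta$ iff there are $T_1,T_2$ with the same $\mathcal F$, $T_1^-\cup T_2^-=T^-$, $T_1\models\alpha$, $T_2\models\beta$; $T\models\Pr(\alpha)>0$ iff $T^-=\emptyset$ or $(T^\alpha)^-\neq\emptyset$. $\varphi_{DC(X,Y)}:=\bigvee_{x\neq x',\,y\neq y',\,\mathbf w\in\mathrm{Ran}(\mathbf W_{XY})}[((\mathbf W_{XY}=\mathbf w\wedge X=x)\Box\!\!\to Y=y)\wedge((\mathbf W_{XY}=\mathbf w\wedge X=x')\Box\!\!\to Y=y')]$; $\varphi_{End(Y)}:=\bigsqcup_{X\in\mathbf W_Y}\varphi_{DC(X,Y)}$. The weak contradictory negation ${}^C$ satisfies, for nonempty $T$,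 $T\models\varphi^C$ iff $T\not\models\varphi$; concretely, with $\varphi_{End(Y)}$ built from $\sqcup,\vee,\wedge,\Box\!\!\to$, it is defined by $(\psi\wedge\chi)^C=\psi^C\sqcup\chi^C$, $(\psi\sqcup\chi)^C=\psi^C\wedge\chi^C$, $(\alpha\supset\chi)^C=\Pr(\alpha)>0\wedge\alpha\supset\chi^C$, $(\mathbf X=\mathbf x\Box\!\!\to\chi)^C=\mathbf X=\mathbf x\Box\!\!\to\chi^C$, $(X=x)^C=\Pr(X=x)<1$, $(X\neq x)^C=\Pr(X\neq x)<1$, $\bot^C=\top$ and vice versa, where $\alpha\vee\beta:=\neg(\neg\alpha\wedge\neg\beta)$, $\neg\alpha:=\alpha\supset\bot$, $\bot:=X=x\Box\!\!\to X\neq x$, $\top:=X=x\Box\!\!\to X=x$. $\psi\to\chi$ is the material conditional: $T\models\psi\to\chi$ iff $T\not\models\psi$ or $T\models\chi$. -}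

module Defs where

open import Data.Nat using (ℕ; zero; suc)
open import Data.Fin using (Fin; zero; suc; _≟_)
open import Data.Bool using (Bool; true; false; _∧_; not)
open import Data.List using (List; []; _∷_; [_]; map; concatMap; filter; allFin; _++_)
open import Data.Bool.ListAction using (any)
open import Data.List.Relation.Unary.All using (All)
open import Data.List.Relation.Unary.Any using (Any)
open import Data.List.Membership.Propositional using (_∈_)
open import Data.List.Relation.Unary.Unique.Propositional using (Unique)
open import Data.List.Relation.Binary.Pointwise using (Pointwise)
open import Relation.Binary.Construct.Closure.Transitive using (TransClosure)
open import Data.Product using (Σ; Σ-syntax; ∃; ∃-syntax; _×_; _,_; proj₁; proj₂)
open import Data.Sum using (_⊎_)
open import Relation.Nullary using (¬_; ¬?)
open import Relation.Nullary.Decidable using (⌊_⌋)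
open import Relation.Binary.PropositionalEquality using (_≡_; _≢_)

-- Signatures σ = (Dom, Ran).
-- Dom = Fin (suc m)  (finite, nonempty, ordered by the order of Fin)
-- Ran(X) = Fin (suc (r X))  (finite, nonempty)

record Signature : Set where
  field
    m : ℕ
    r : Fin (suc m) → ℕ

data Filt {A : Set} (P : A → Set) : List A → List A → Set where
  f[]   : Filt P [] []
  keep  : ∀ {e T T'} → P e → Filt P T T' → Filt P (e ∷ T) (e ∷ T')
  drop  : ∀ {e T T'} → ¬ P e → Filt P T T' → Filt P (e ∷ T) T'

module Semantics (σ : Signature) where
  open Signature σ

  Var : Set
  Var = Fin (suc m)

  Val : Var → Set
  Val X = Fin (suc (r X))

  Assignment : Set
  Assignment = (X : Var) → Val X

  KA : Set
  KA = ℕ × Assignment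

  -- multiteams as lists of keyed assignments (distinctness of keys is
  -- required in the notion of causal multiteam below)
  Team : Set
  Team = List KA

  -- conjunctions X₁ = x₁ ∧ … ∧ Xₙ = xₙ of atoms (antecedents of □→)
  Interv : Set
  Interv = List (Σ Var Val)

  Inconsistent : Interv → Set
  Inconsistent I = Σ[ p ∈ Σ Var Val ] Σ[ q ∈ Σ Var Val ]
                     (p ∈ I × q ∈ I × proj₁ p ≡ proj₁ q × p ≢ q)

  inI : Var → Interv → Bool
  inI V I = any (λ p → ⌊ proj₁ p ≟ V ⌋) I

  -- function component: End ⊆ Dom and, for each V, F V : Assignment → Val V
  -- (only meaningful for endogenous V; required below to ignore the
  -- V-component, so that it is a function Ran(W_V) → Ran(V))
  record Model : Set where
    field
      End : Var → Bool
      F   : (V : Var) → Assignment → Val V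
  open Model public

  AgreeOutside : Var → Assignment → Assignment → Set
  AgreeOutside X s s' = ∀ Z → Z ≢ X → s Z ≡ s' Z

  -- arrow X → V of the causal graph: V endogenous and F_V depends on X
  Edge : Model → Var → Var → Set
  Edge M X V = End M V ≡ true ×
               (Σ[ s ∈ Assignment ] Σ[ s' ∈ Assignment ]
                  (AgreeOutside X s s' × F M V s ≢ F M V s'))

  Acyclic : Model → Set
  Acyclic M = ∀ V → ¬ TransClosure (Edge M) V V

  record CausalMultiteam : Set where
    field
      model       : Model
      team        : Team
      keysDistinct : Unique (map proj₁ team)
      onlyWV      : ∀ V → End model V ≡ true →
                    ∀ s s' → AgreeOutside V s s' → F model V s ≡ F model V s'
      nonConstant : ∀ V → End model V ≡ true →
                    Σ[ s ∈ Assignment ] Σ[ s' ∈ Assignment ] (F model V s ≢ F model V s')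
      compatible  : ∀ e → e ∈ team → ∀ V → End model V ≡ true →
                    F model V (proj₂ e) ≡ proj₂ e V
      acyclic     : Acyclic model

  Solution : Model → Interv → Assignment → Assignment → Set
  Solution M I s s' =
      (∀ p → p ∈ I → s' (proj₁ p) ≡ proj₂ p)
    × (∀ V → inI V I ≡ false → End M V ≡ false → s' V ≡ s V)
    × (∀ V → inI V I ≡ false → End M V ≡ true → s' V ≡ F M V s')

  -- T' = T_{I}^- (keys kept, each element replaced by its intervened version)
  IntervTeam : Model → Interv → Team → Team → Set
  IntervTeam M I T T' =
    Pointwise (λ e e' → proj₁ e' ≡ proj₁ e × Solution M I (proj₂ e) (proj₂ e')) T T'

  intervModel : Model → Interv → Model
  intervModel M I = record { End = λ V → End M V ∧ not (inI V I) ; F = F M }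

  infixr 4 _⇒_
  infixr 5 _⊔'_ _∨'_
  infixr 6 _∧'_
  infixr 7 _⊃'_ _□→_
  infix 8 _≐_ _≠'_

  data Fml : Set where
    _≐_   : (X : Var) → Val X → Fml
    _≠'_  : (X : Var) → Val X → Fml
    ⊥' ⊤' : Fml                            -- ⊥ := X=x □→ X≠x, ⊤ := X=x □→ X=x
    _∧'_  : Fml → Fml → Fml
    _⊔'_  : Fml → Fml → Fml
    _∨'_  : Fml → Fml → Fml
    _⊃'_  : Fml → Fml → Fml
    _□→_  : Interv → Fml → Fml
    Pr>0  : Fml → Fml
    Pr<1  : Fml → Fml
    _⇒_   : Fml → Fml → Fml

  ¬'_ : Fml → Fml
  ¬' α = α ⊃' ⊥'

  -- the fixed variable/value used in the abbreviations ⊥ and ⊤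
  X₀ : Var
  X₀ = zero
  x₀ : Val X₀
  x₀ = zero

  infix 3 _∣_⊨_ _⊨_
  _∣_⊨_ : Model → Team → Fml → Set
  M ∣ T ⊨ (X ≐ x) = All (λ e → proj₂ e X ≡ x) T
  M ∣ T ⊨ (X ≠' x) = All (λ e → proj₂ e X ≢ x) T
  M ∣ T ⊨ ⊥' = ∀ T' → IntervTeam M [ (X₀ , x₀) ] T T' → All (λ e → proj₂ e X₀ ≢ x₀) T'
  M ∣ T ⊨ ⊤' = ∀ T' → IntervTeam M [ (X₀ , x₀) ] T T' → All (λ e → proj₂ e X₀ ≡ x₀) T'
  M ∣ T ⊨ (ψ ∧' χ) = (M ∣ T ⊨ ψ) × (M ∣ T ⊨ χ)
  M ∣ T ⊨ (ψ ⊔' χ) = (M ∣ T ⊨ ψ) ⊎ (M ∣ T ⊨ χ)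
  M ∣ T ⊨ (α ∨' β) = Σ[ T₁ ∈ Team ] Σ[ T₂ ∈ Team ]
      ((∀ e → e ∈ T → e ∈ T₁ ⊎ e ∈ T₂) × (∀ e → e ∈ T₁ → e ∈ T) × (∀ e → e ∈ T₂ → e ∈ T)
       × (M ∣ T₁ ⊨ α) × (M ∣ T₂ ⊨ β))
  M ∣ T ⊨ (α ⊃' ψ) = ∀ T' → Filt (λ e → M ∣ [ e ] ⊨ α) T T' → M ∣ T' ⊨ ψ
  M ∣ T ⊨ (I □→ ψ) = Inconsistent I ⊎ (∀ T' → IntervTeam M I T T' → intervModel M I ∣ T' ⊨ ψ)
  M ∣ T ⊨ Pr>0 α = T ≡ [] ⊎ Any (λ e → M ∣ [ e ] ⊨ α) T
  M ∣ T ⊨ Pr<1 α = T ≡ [] ⊎ Any (λ e → ¬ (M ∣ [ e ] ⊨ α)) T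
  M ∣ T ⊨ (ψ ⇒ χ) = (M ∣ T ⊨ ψ) → (M ∣ T ⊨ χ)

  _⊨_ : CausalMultiteam → Fml → Set
  T ⊨ φ = CausalMultiteam.model T ∣ CausalMultiteam.team T ⊨ φ

  -- Weak contradictory negation (clauses as in the paper; the last three
  -- clauses are outside the fragment used and never applied here)

  _ᶜ : Fml → Fml
  (X ≐ x) ᶜ = Pr<1 (X ≐ x)
  (X ≠' x) ᶜ = Pr<1 (X ≠' x)
  ⊥' ᶜ = ⊤'
  ⊤' ᶜ = ⊥'
  (ψ ∧' χ) ᶜ = (ψ ᶜ) ⊔' (χ ᶜ)
  (ψ ⊔' χ) ᶜ = (ψ ᶜ) ∧' (χ ᶜ)
  -- α ∨ β := ¬(¬α ∧ ¬β) = (¬α ∧ ¬β) ⊃ ⊥, so its C-negation is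
  -- Pr(¬α ∧ ¬β) > 0 ∧ ((¬α ∧ ¬β) ⊃ ⊥ᶜ) with ⊥ᶜ = ⊤
  (α ∨' β) ᶜ = Pr>0 (¬' α ∧' ¬' β) ∧' ((¬' α ∧' ¬' β) ⊃' ⊤')
  (α ⊃' χ) ᶜ = Pr>0 α ∧' (α ⊃' (χ ᶜ))
  (I □→ χ) ᶜ = I □→ (χ ᶜ)
  (Pr>0 α) ᶜ = α ⊃' ⊥'
  (Pr<1 α) ᶜ = α
  (ψ ⇒ χ) ᶜ = ψ ∧' (χ ᶜ)

  vars : List Var
  vars = allFin (suc m)

  W₁ : Var → List Var
  W₁ V = filter (λ Z → ¬? (Z ≟ V)) vars

  W₂ : Var → Var → List Var
  W₂ X Y = filter (λ Z → ¬? (Z ≟ Y)) (filter (λ Z → ¬? (Z ≟ X)) vars)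

  ranW : List Var → List Interv
  ranW [] = [] ∷ []
  ranW (Z ∷ Zs) = concatMap (λ v → map ((Z , v) ∷_) (ranW Zs)) (allFin (suc (r Z)))

  distinctPairs : (X : Var) → List (Val X × Val X)
  distinctPairs X =
    filter (λ p → ¬? (proj₁ p ≟ proj₂ p))
      (concatMap (λ a → map (a ,_) (allFin (suc (r X)))) (allFin (suc (r X))))

  ⨆ : List Fml → Fml
  ⨆ [] = ⊥'
  ⨆ (φ ∷ []) = φ
  ⨆ (φ ∷ φs@(_ ∷ _)) = φ ⊔' ⨆ φs

  ⋁ : List Fml → Fml
  ⋁ [] = ⊥'
  ⋁ (φ ∷ []) = φ
  ⋁ (φ ∷ φs@(_ ∷ _)) = φ ∨' ⋁ φs

  φDC : Var → Var → Fml
  φDC X Y =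
    ⋁ (concatMap (λ xx →
         concatMap (λ yy →
           map (λ w → ((w ++ [ (X , proj₁ xx) ]) □→ (Y ≐ proj₁ yy))
                    ∧' ((w ++ [ (X , proj₂ xx) ]) □→ (Y ≐ proj₂ yy)))
               (ranW (W₂ X Y)))
           (distinctPairs Y))
         (distinctPairs X))

  φEnd : Var → Fml
  φEnd Y = ⨆ (map (λ X → φDC X Y) (W₁ Y))

module Submission where

-- If Y is exogenous, an intervention on W_Y leaves Y untouched, so Y = y survives it.
-- If Y is endogenous, (φ_End(Y))^C holds only on the empty team. Since F_Y is not
-- constant, Y has a direct cause Z, witnessed by assignments p, q that differ only at
-- Z and have F_Y(p) ≠ F_Y(q). The interventions W_ZY = p(W_ZY), Z = p(Z) and
-- W_ZY = p(W_ZY), Z = q(Z) fix all of W_Y and so force Y = F_Y(p), resp. Y = F_Y(q);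
-- this disjunct of φ_DC(Z, Y) holds on every team and its C-negation fails on every
-- nonempty one. The C-negation of the tensor disjunction φ_DC(Z, Y) itself demands ⊥
-- on a singleton team, which is refuted because in an acyclic model the intervention
-- X₀ = x₀ defining ⊥ has a solution: iterating the structural equations n times
-- reaches a fixed point.

open import Defs
open import Data.Nat using (ℕ; zero; suc; _+_; _≤_)
open import Data.Nat.Properties using (+-suc; +-comm; m≤m+n; <⇒≱)
open import Data.Fin using (Fin; zero; suc; _≟_)
open import Data.Fin.Properties using (injective⇒≤)
open import Data.Bool using (true; false)
open import Data.List using (List; []; _∷_; [_]; map; concatMap; filter; allFin; _++_; length; lookup)
open import Data.List.Relation.Unary.All as All using (All; []; _∷_)
open import Data.List.Relation.Unary.Any using (here; there; satisfied)
open import Data.List.Relation.Unary.Any.Properties using (map⁻)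
open import Data.List.Relation.Unary.AllPairs using (AllPairs; []; _∷_)
open import Data.List.Membership.Propositional using (_∈_; lose)
open import Data.List.Membership.Propositional.Properties
  using (∈-allFin; ∈-lookup; ∈-++⁻; ∈-++⁺ˡ; ∈-++⁺ʳ; ∈-map⁺; ∈-map⁻; ∈-filter⁺; ∈-filter⁻; ∈-concatMap⁺; ∈-concatMap⁻)
open import Data.List.Relation.Binary.Pointwise using ([]; _∷_)
open import Relation.Binary.Construct.Closure.Transitive using (TransClosure) renaming ([_] to [_]⁺; _∷_ to _∷⁺_)
open import Data.Product using (Σ-syntax; _×_; _,_; proj₁; proj₂)
open import Data.Sum using (inj₁; inj₂; [_,_]′)
open import Data.Empty using (⊥-elim)
open import Function.Definitions using (Injective)
open import Relation.Nullary using (¬_; yes; no; ¬?)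
open import Relation.Binary.Definitions using (DecidableEquality)
open import Relation.Binary.PropositionalEquality using (_≡_; _≢_; refl; sym; trans; cong; subst)

lookup-injective : {A : Set} {R : A → A → Set} → (∀ {x} → ¬ R x x) →
                   ∀ {xs} → AllPairs R xs → Injective _≡_ _≡_ (lookup xs)
lookup-injective irr (_ ∷ _) {zero} {zero} _ = refl
lookup-injective {R = R} irr (Rx ∷ _) {zero} {suc j} eq =
  ⊥-elim (irr (subst (R _) (sym eq) (All.lookup Rx (∈-lookup j))))
lookup-injective {R = R} irr (Rx ∷ _) {suc i} {zero} eq =
  ⊥-elim (irr (subst (R _) eq (All.lookup Rx (∈-lookup i))))
lookup-injective irr (_ ∷ Rxs) {suc i} {suc j} eq =
  cong suc (lookup-injective irr Rxs eq)

AllPairs-length≤ : ∀ {n} {R : Fin n → Fin n → Set} → (∀ {x} → ¬ R x x) →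
                   ∀ {xs} → AllPairs R xs → length xs ≤ n
AllPairs-length≤ irr Rxs = injective⇒≤ (lookup-injective irr Rxs)

module AcyclicIteration {n} {A : Fin n → Set} (_⇾_ : Fin n → Fin n → Set)
         (acyclic : ∀ i → ¬ TransClosure _⇾_ i i)
         (h : ∀ i → (∀ j → A j) → A i)
         (local : ∀ i t t' → (∀ j → j ⇾ i → t j ≡ t' j) → h i t ≡ h i t')
         where

  step : (∀ j → A j) → (∀ j → A j)
  step t i = h i t

  iterate : ℕ → (∀ j → A j) → (∀ j → A j)
  iterate zero t = t
  iterate (suc k) t = step (iterate k t)

  -- After k steps the value at i depends only on the values of its parents after
  -- k − 1 steps; following parents extends the ancestor chain i ∷ is, which
  -- acyclicity keeps shorter than n + 1.
  iterate-stable : ∀ t k j {i is} → n ≤ k + length is →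
                   AllPairs (TransClosure _⇾_) (i ∷ is) →
                   iterate (k + j) t i ≡ iterate k t i
  iterate-stable t zero j n≤ chain =
    ⊥-elim (<⇒≱ (AllPairs-length≤ (λ {x} → acyclic x) chain) n≤)
  iterate-stable t (suc k) j {i} {is} n≤ (i⇾⁺is ∷ chain) =
    local i _ _ λ p p⇾i → iterate-stable t k j (subst (n ≤_) (sym (+-suc k (length is))) n≤)
                            (([ p⇾i ]⁺ ∷ All.map (p⇾i ∷⁺_) i⇾⁺is) ∷ i⇾⁺is ∷ chain)

  fixpoint : ∀ t i → step (iterate n t) i ≡ iterate n t i
  fixpoint t i = subst (λ k → iterate k t i ≡ iterate n t i) (+-comm n 1)
                   (iterate-stable t n 1 (m≤m+n n 0) ([] ∷ []))

Filt⇒All : ∀ {A : Set} {P : A → Set} {xs ys} → Filt P xs ys → All P ys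
Filt⇒All f[] = []
Filt⇒All (keep Px f) = Px ∷ Filt⇒All f
Filt⇒All (drop _ f) = Filt⇒All f

∈-concatMap-via : ∀ {A B : Set} (f : A → List B) {x xs y} → x ∈ xs → y ∈ f x →
                  y ∈ concatMap f xs
∈-concatMap-via f x∈xs y∈fx = ∈-concatMap⁺ f (lose x∈xs y∈fx)

module _ (σ : Signature) where
  open Semantics σ
  open Signature σ using (m; r)

  ⊨-[] : ∀ M φ → M ∣ [] ⊨ φ
  ⊨-[] M (X ≐ x) = []
  ⊨-[] M (X ≠' x) = []
  ⊨-[] M ⊥' = λ { .[] [] → [] }
  ⊨-[] M ⊤' = λ { .[] [] → [] }
  ⊨-[] M (ψ ∧' χ) = ⊨-[] M ψ , ⊨-[] M χ
  ⊨-[] M (ψ ⊔' χ) = inj₁ (⊨-[] M ψ)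
  ⊨-[] M (ψ ∨' χ) = [] , [] , (λ _ ()) , (λ _ ()) , (λ _ ()) , ⊨-[] M ψ , ⊨-[] M χ
  ⊨-[] M (ψ ⊃' χ) = λ { .[] f[] → ⊨-[] M χ }
  ⊨-[] M (I □→ ψ) = inj₂ λ { .[] [] → ⊨-[] (intervModel M I) ψ }
  ⊨-[] M (Pr>0 ψ) = inj₁ refl
  ⊨-[] M (Pr<1 ψ) = inj₁ refl
  ⊨-[] M (ψ ⇒ χ) = λ _ → ⊨-[] M χ

  ⋁-intro : ∀ {M φ e} L → φ ∈ L → M ∣ [ e ] ⊨ φ → M ∣ [ e ] ⊨ ⋁ L
  ⋁-intro (_ ∷ []) (here refl) ⊨φ = ⊨φ
  ⋁-intro {M} (_ ∷ _ ∷ _) (here refl) ⊨φ =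
    _ , [] , (λ _ → inj₁) , (λ _ e∈ → e∈) , (λ _ ()) , ⊨φ , ⊨-[] M _
  ⋁-intro {M} (_ ∷ L@(_ ∷ _)) (there φ∈L) ⊨φ =
    [] , _ , (λ _ → inj₂) , (λ _ ()) , (λ _ e∈ → e∈) , ⊨-[] M _ , ⋁-intro L φ∈L ⊨φ

  ⨆ᶜ-elim : ∀ {M T φ} L → φ ∈ L → M ∣ T ⊨ (⨆ L) ᶜ → M ∣ T ⊨ φ ᶜ
  ⨆ᶜ-elim (_ ∷ []) (here refl) ⊨ᶜ = ⊨ᶜ
  ⨆ᶜ-elim (_ ∷ _ ∷ _) (here refl) (⊨ᶜ , _) = ⊨ᶜ
  ⨆ᶜ-elim (_ ∷ L@(_ ∷ _)) (there φ∈L) (_ , ⊨ᶜ) = ⨆ᶜ-elim L φ∈L ⊨ᶜ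

  _[_≔_] : Assignment → (Z : Var) → Val Z → Assignment
  (t [ Z ≔ v ]) W with W ≟ Z
  ... | yes refl = v
  ... | no _ = t W

  ≔-same : ∀ {t Z v} → (t [ Z ≔ v ]) Z ≡ v
  ≔-same {Z = Z} with Z ≟ Z
  ... | yes refl = refl
  ... | no Z≢Z = ⊥-elim (Z≢Z refl)

  ≔-other : ∀ {t Z v W} → W ≢ Z → (t [ Z ≔ v ]) W ≡ t W
  ≔-other {Z = Z} {W = W} W≢Z with W ≟ Z
  ... | yes W≡Z = ⊥-elim (W≢Z W≡Z)
  ... | no _ = refl

  ≔-agreeOutside : ∀ {t Z v} → AgreeOutside Z t (t [ Z ≔ v ])
  ≔-agreeOutside W W≢Z = sym (≔-other W≢Z)

  agree-everywhere : ∀ {Z p q} → AgreeOutside Z p q → p Z ≡ q Z → ∀ W → p W ≡ q W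
  agree-everywhere {Z} p~q pZ≡qZ W with W ≟ Z
  ... | yes refl = pZ≡qZ
  ... | no W≢Z = p~q W W≢Z

  mix : List Var → Assignment → Assignment → Assignment
  mix [] a b = a
  mix (Z ∷ Zs) a b = mix Zs a b [ Z ≔ b Z ]

  mix-∈ : ∀ {Zs a b W} → W ∈ Zs → mix Zs a b W ≡ b W
  mix-∈ (here refl) = ≔-same
  mix-∈ {Z ∷ Zs} {a} {b} {W} (there W∈Zs) with W ≟ Z
  ... | yes refl = refl
  ... | no _ = mix-∈ W∈Zs

  mix-agree : ∀ Zs {a b W} → a W ≡ b W → mix Zs a b W ≡ b W
  mix-agree [] aW≡bW = aW≡bW
  mix-agree (Z ∷ Zs) {a} {b} {W} aW≡bW with W ≟ Z
  ... | yes refl = refl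
  ... | no _ = mix-agree Zs aW≡bW

  Extensional : {B : Set} → (Assignment → B) → Set
  Extensional f = ∀ t t' → (∀ W → t W ≡ t' W) → f t ≡ f t'

  OneVariableChange : {B : Set} → (Assignment → B) → Assignment → Assignment → Set
  OneVariableChange f a b =
    Σ[ Z ∈ Var ] Σ[ p ∈ Assignment ] Σ[ q ∈ Assignment ]
      AgreeOutside Z p q × f p ≢ f q × (a Z ≡ b Z → p Z ≡ q Z)

  -- Walking from a to b one variable at a time, f changes at some step.
  changes-at-one-variable :
    {B : Set} → DecidableEquality B → (f : Assignment → B) → Extensional f →
    ∀ a b → f a ≢ f b → OneVariableChange f a b
  changes-at-one-variable _≟B_ f f-ext a b fa≢fb =
    along (allFin _) (λ fa≡ → fa≢fb (trans fa≡ (f-ext _ _ (λ W → mix-∈ (∈-allFin W)))))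
    where
    along : ∀ Zs → f a ≢ f (mix Zs a b) → OneVariableChange f a b
    along [] fa≢fa = ⊥-elim (fa≢fa refl)
    along (Z ∷ Zs) fa≢ with f (mix Zs a b) ≟B f (mix (Z ∷ Zs) a b)
    ... | yes eq = along Zs (λ eq' → fa≢ (trans eq' eq))
    ... | no ne = Z , mix Zs a b , mix (Z ∷ Zs) a b , ≔-agreeOutside , ne ,
                  λ aZ≡bZ → trans (mix-agree Zs aZ≡bZ) (sym ≔-same)

  inI-∈ : ∀ {V v I} → (V , v) ∈ I → inI V I ≡ true
  inI-∈ {V} (here refl) with V ≟ V
  ... | yes _ = refl
  ... | no V≢V = ⊥-elim (V≢V refl)
  inI-∈ {V} {I = (W , _) ∷ I} (there V∈I) with W ≟ V
  ... | yes _ = refl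
  ... | no _ = inI-∈ V∈I

  inI-∉ : ∀ {V} I → (∀ {W w} → (W , w) ∈ I → W ≢ V) → inI V I ≡ false
  inI-∉ [] _ = refl
  inI-∉ {V} ((W , _) ∷ I) ∉I with W ≟ V
  ... | yes W≡V = ⊥-elim (∉I (here refl) W≡V)
  ... | no _ = inI-∉ I (λ W∈I → ∉I (there W∈I))

  inI-false⇒∉ : ∀ {V v I} → inI V I ≡ false → ¬ (V , v) ∈ I
  inI-false⇒∉ V∉I V∈I with trans (sym V∉I) (inI-∈ V∈I)
  ... | ()

  exogenous-preserved : ∀ {M Y y I T T'} → End M Y ≡ false → inI Y I ≡ false →
                        IntervTeam M I T T' →
                        All (λ e → proj₂ e Y ≡ y) T → All (λ e → proj₂ e Y ≡ y) T'
  exogenous-preserved exoY Y∉I [] [] = []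
  exogenous-preserved exoY Y∉I ((_ , (_ , exogenous , _)) ∷ sols) (Y≡y ∷ Ys≡y) =
    trans (exogenous _ Y∉I exoY) Y≡y ∷ exogenous-preserved exoY Y∉I sols Ys≡y

  _↾_ : Assignment → List Var → Interv
  t ↾ Zs = map (λ V → V , t V) Zs

  ↾-∈-ranW : ∀ Zs t → t ↾ Zs ∈ ranW Zs
  ↾-∈-ranW [] t = here refl
  ↾-∈-ranW (Z ∷ Zs) t =
    ∈-concatMap-via (λ v → map ((Z , v) ∷_) (ranW Zs)) (∈-allFin (t Z))
      (∈-map⁺ ((Z , t Z) ∷_) (↾-∈-ranW Zs t))

  ranW-vars : ∀ Zs {w} → w ∈ ranW Zs → ∀ {W v} → (W , v) ∈ w → W ∈ Zs
  ranW-vars [] (here refl) ()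
  ranW-vars (Z ∷ Zs) w∈ W∈w
    with _ , w∈′ ← satisfied (∈-concatMap⁻ (λ v → map ((Z , v) ∷_) (ranW Zs)) {xs = allFin _} w∈)
    with _ , w′∈ , refl ← ∈-map⁻ _ w∈′
    with W∈w
  ... | here refl = here refl
  ... | there W∈w′ = there (ranW-vars Zs w′∈ W∈w′)

  ∈-distinctPairs : ∀ {X} {a b : Val X} → a ≢ b → (a , b) ∈ distinctPairs X
  ∈-distinctPairs {X} {a} {b} a≢b =
    ∈-filter⁺ (λ p → ¬? (proj₁ p ≟ proj₂ p))
      (∈-concatMap-via (λ a → map (a ,_) (allFin (suc (r X)))) (∈-allFin a) (∈-map⁺ (a ,_) (∈-allFin b)))
      a≢b

  ∈-W₁⁺ : ∀ {Z Y} → Z ≢ Y → Z ∈ W₁ Y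
  ∈-W₁⁺ {Z} = ∈-filter⁺ (λ V → ¬? (V ≟ _)) (∈-allFin Z)

  ∈-W₁⁻ : ∀ {Z Y} → Z ∈ W₁ Y → Z ≢ Y
  ∈-W₁⁻ {Y = Y} Z∈ = proj₂ (∈-filter⁻ (λ V → ¬? (V ≟ Y)) {xs = vars} Z∈)

  ∈-W₂⁺ : ∀ {V X Y} → V ≢ X → V ≢ Y → V ∈ W₂ X Y
  ∈-W₂⁺ {V} {X} {Y} V≢X = ∈-filter⁺ (λ V → ¬? (V ≟ Y)) (∈-filter⁺ (λ V → ¬? (V ≟ X)) (∈-allFin V) V≢X)

  ∈-W₂⁻ : ∀ {V X Y} → V ∈ W₂ X Y → V ≢ X × V ≢ Y
  ∈-W₂⁻ {V} {X} {Y} V∈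
    with V∈′ , V≢Y ← ∈-filter⁻ (λ V → ¬? (V ≟ Y)) {xs = filter (λ V → ¬? (V ≟ X)) vars} V∈
    = proj₂ (∈-filter⁻ (λ V → ¬? (V ≟ X)) {xs = vars} V∈′) , V≢Y

  dcDisjuncts : Var → Var → List Fml
  dcDisjuncts X Y =
    concatMap (λ xx →
      concatMap (λ yy →
        map (λ w → ((w ++ [ (X , proj₁ xx) ]) □→ (Y ≐ proj₁ yy))
                 ∧' ((w ++ [ (X , proj₂ xx) ]) □→ (Y ≐ proj₂ yy)))
            (ranW (W₂ X Y)))
        (distinctPairs Y))
      (distinctPairs X)

  ∈-dcDisjuncts : ∀ {X Y} {x x' : Val X} {y y' : Val Y} {w} →
                  x ≢ x' → y ≢ y' → w ∈ ranW (W₂ X Y) →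
                  (((w ++ [ (X , x) ]) □→ (Y ≐ y)) ∧' ((w ++ [ (X , x') ]) □→ (Y ≐ y')))
                    ∈ dcDisjuncts X Y
  ∈-dcDisjuncts {X} {Y} {x} {x'} {y} {y'} x≢x' y≢y' w∈ =
    ∈-concatMap-via _ (∈-distinctPairs x≢x')
      (∈-concatMap-via _ (∈-distinctPairs y≢y')
        (∈-map⁺ (λ w → ((w ++ [ (X , x) ]) □→ (Y ≐ y)) ∧' ((w ++ [ (X , x') ]) □→ (Y ≐ y'))) w∈))

  module CausalModel (C : CausalMultiteam) where
    open CausalMultiteam C using (model; onlyWV; nonConstant; acyclic)

    M : Model
    M = model

    F-extensional : ∀ {V} → End M V ≡ true → Extensional (F M V)
    F-extensional endV t t' t≗t' = onlyWV _ endV t t' (λ W _ → t≗t' W)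

    F-local : ∀ {V} → End M V ≡ true → ∀ t t' → (∀ X → Edge M X V → t X ≡ t' X) →
              F M V t ≡ F M V t'
    F-local {V} endV t t' agree with F M V t ≟ F M V t'
    ... | yes eq = eq
    ... | no ne with changes-at-one-variable _≟_ (F M V) (F-extensional endV) t t' ne
    ... | Z , p , q , p~q , Fp≢Fq , sameZ =
      ⊥-elim (Fp≢Fq (F-extensional endV p q
                       (agree-everywhere p~q (sameZ (agree Z (endV , p , q , p~q , Fp≢Fq))))))

    direct-cause : ∀ {Y} → End M Y ≡ true →
                   Σ[ Z ∈ Var ] Σ[ p ∈ Assignment ] Σ[ q ∈ Assignment ]
                     AgreeOutside Z p q × F M Y p ≢ F M Y q
    direct-cause endY with nonConstant _ endY
    ... | a , b , Fa≢Fb with changes-at-one-variable _≟_ _ (F-extensional endY) a b Fa≢Fb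
    ... | Z , p , q , p~q , Fp≢Fq , _ = Z , p , q , p~q , Fp≢Fq

    -- The structural equations of the intervention X₀ = x₀, with exogenous values from s.
    clamp : Assignment → (V : Var) → Assignment → Val V
    clamp s V t with V ≟ X₀ | End M V
    ... | yes refl | _ = x₀
    ... | no _ | true = F M V t
    ... | no _ | false = s V

    clamp-pinned : ∀ {s t} → clamp s X₀ t ≡ x₀
    clamp-pinned with X₀ ≟ X₀
    ... | yes refl = refl
    ... | no X₀≢X₀ = ⊥-elim (X₀≢X₀ refl)

    clamp-endogenous : ∀ {s t V} → V ≢ X₀ → End M V ≡ true → clamp s V t ≡ F M V t
    clamp-endogenous {V = V} V≢X₀ endV with V ≟ X₀ | End M V
    ... | yes V≡X₀ | _ = ⊥-elim (V≢X₀ V≡X₀)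
    ... | no _ | true = refl
    ... | no _ | false with () ← endV

    clamp-exogenous : ∀ {s t V} → V ≢ X₀ → End M V ≡ false → clamp s V t ≡ s V
    clamp-exogenous {V = V} V≢X₀ exoV with V ≟ X₀ | End M V
    ... | yes V≡X₀ | _ = ⊥-elim (V≢X₀ V≡X₀)
    ... | no _ | false = refl
    ... | no _ | true with () ← exoV

    clamp-local : ∀ s V t t' → (∀ X → Edge M X V → t X ≡ t' X) → clamp s V t ≡ clamp s V t'
    clamp-local s V t t' agree with V ≟ X₀ | End M V in endV
    ... | yes refl | _ = refl
    -- the with has turned End M V into true inside the type of agree
    ... | no _ | true = F-local endV t t' (λ X (_ , X-matters) → agree X (refl , X-matters))
    ... | no _ | false = refl

    module Clamped (s : Assignment) = AcyclicIteration (Edge M) acyclic (clamp s) (clamp-local s)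

    X₀-solution : ∀ s → Solution M [ (X₀ , x₀) ] s (Clamped.iterate s (suc m) s)
    X₀-solution s = pinned , exogenous , endogenous
      where
      open Clamped s
      unpinned : ∀ {V} → inI V [ (X₀ , x₀) ] ≡ false → V ≢ X₀
      unpinned V∉ refl = inI-false⇒∉ {I = [ (X₀ , x₀) ]} V∉ (here refl)
      pinned : ∀ p → p ∈ [ (X₀ , x₀) ] → iterate (suc m) s (proj₁ p) ≡ proj₂ p
      pinned _ (here refl) = clamp-pinned {s} {iterate m s}
      exogenous : ∀ V → inI V [ (X₀ , x₀) ] ≡ false → End M V ≡ false →
                  iterate (suc m) s V ≡ s V
      exogenous V V∉ exoV = clamp-exogenous (unpinned V∉) exoV
      endogenous : ∀ V → inI V [ (X₀ , x₀) ] ≡ false → End M V ≡ true →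
                   iterate (suc m) s V ≡ F M V (iterate (suc m) s)
      endogenous V V∉ endV = trans (sym (fixpoint s V)) (clamp-endogenous (unpinned V∉) endV)

    ⊥-fails-on-singleton : ∀ e → ¬ (M ∣ [ e ] ⊨ ⊥')
    ⊥-fails-on-singleton (k , s) ⊨⊥ with ⊨⊥ _ ((refl , X₀-solution s) ∷ [])
    ... | s*X₀≢x₀ ∷ [] = s*X₀≢x₀ (proj₁ (X₀-solution s) _ (here refl))

    ⋁ᶜ-fails : ∀ {φ e T} L → φ ∈ L → (∀ e → M ∣ [ e ] ⊨ φ) → ¬ (M ∣ e ∷ T ⊨ φ ᶜ) →
               ¬ (M ∣ e ∷ T ⊨ (⋁ L) ᶜ)
    ⋁ᶜ-fails (_ ∷ []) (here refl) _ ¬φᶜ = ¬φᶜ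
    ⋁ᶜ-fails (_ ∷ L@(_ ∷ _)) φ∈ ⊨φ _ (inj₂ some , _) with satisfied some
    ... | e , ¬head , ¬rest with φ∈
    ... | here refl = ⊥-fails-on-singleton e (¬head _ (keep (⊨φ e) f[]))
    ... | there φ∈L = ⊥-fails-on-singleton e (¬rest _ (keep (⋁-intro L φ∈L (⊨φ e)) f[]))

    -- I is the intervention W_Y = t(W_Y), listed in any order.
    record FixesAllBut (Y : Var) (t : Assignment) (I : Interv) : Set where
      field
        agrees : ∀ {V v} → (V , v) ∈ I → v ≡ t V
        covers : ∀ V → V ≢ Y → Σ[ v ∈ Val V ] (V , v) ∈ I
        avoids : ∀ {V v} → (V , v) ∈ I → V ≢ Y

    module _ {Y t I} (endY : End M Y ≡ true) (fixes : FixesAllBut Y t I) where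
      open FixesAllBut fixes

      FixesAllBut⇒consistent : ¬ Inconsistent I
      FixesAllBut⇒consistent ((V , v) , (.V , v') , V∈I , V'∈I , refl , v≢v') =
        v≢v' (cong (V ,_) (trans (agrees V∈I) (sym (agrees V'∈I))))

      unfixed⇒≡Y : ∀ {V} → inI V I ≡ false → V ≡ Y
      unfixed⇒≡Y {V} V∉I with V ≟ Y
      ... | yes V≡Y = V≡Y
      ... | no V≢Y = ⊥-elim (inI-false⇒∉ V∉I (proj₂ (covers V V≢Y)))

      solution-agrees-off-Y : ∀ {s s'} → Solution M I s s' → AgreeOutside Y s' t
      solution-agrees-off-Y (fixed , _) V V≢Y =
        trans (fixed _ (proj₂ (covers V V≢Y))) (agrees (proj₂ (covers V V≢Y)))

      forced-value : ∀ T → M ∣ T ⊨ (I □→ (Y ≐ F M Y t))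
      forced-value _ = inj₂ (λ _ → forced)
        where
        forced : ∀ {T T'} → IntervTeam M I T T' → All (λ e → proj₂ e Y ≡ F M Y t) T'
        forced [] = []
        forced ((_ , sol@(_ , _ , endogenous)) ∷ sols) =
          trans (endogenous Y (inI-∉ I avoids) endY)
                (onlyWV Y endY _ t (solution-agrees-off-Y sol))
            ∷ forced sols

      forced-solution : ∀ s → Solution M I s (t [ Y ≔ F M Y t ])
      forced-solution s = fixed , exogenous , endogenous
        where
        fixed : ∀ p → p ∈ I → (t [ Y ≔ F M Y t ]) (proj₁ p) ≡ proj₂ p
        fixed _ V∈I = trans (≔-other (avoids V∈I)) (sym (agrees V∈I))
        exogenous : ∀ V → inI V I ≡ false → End M V ≡ false → (t [ Y ≔ F M Y t ]) V ≡ s V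
        exogenous V V∉I exoV with unfixed⇒≡Y V∉I
        ... | refl with () ← trans (sym exoV) endY
        endogenous : ∀ V → inI V I ≡ false → End M V ≡ true →
                     (t [ Y ≔ F M Y t ]) V ≡ F M V (t [ Y ≔ F M Y t ])
        endogenous V V∉I _ with unfixed⇒≡Y V∉I
        ... | refl = trans ≔-same (onlyWV Y endY t _ ≔-agreeOutside)

      forced-intervention : ∀ T → IntervTeam M I T (map (λ e → proj₁ e , t [ Y ≔ F M Y t ]) T)
      forced-intervention [] = []
      forced-intervention (e ∷ T) = (refl , forced-solution (proj₂ e)) ∷ forced-intervention T

      forced-valueᶜ-fails : ∀ {e T} → ¬ (M ∣ e ∷ T ⊨ (I □→ (Y ≐ F M Y t)) ᶜ)
      forced-valueᶜ-fails (inj₁ inconsistent) = FixesAllBut⇒consistent inconsistent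
      forced-valueᶜ-fails {e} {T} (inj₂ ⊨Pr<1) with ⊨Pr<1 _ (forced-intervention (e ∷ T))
      ... | inj₂ some-Y≢ with satisfied (map⁻ {xs = e ∷ T} some-Y≢)
      ... | _ , Y≢ = Y≢ (≔-same ∷ [])

    fixesAllBut-W₂ : ∀ {Y Z p t} → Z ≢ Y → AgreeOutside Z p t →
                     FixesAllBut Y t ((p ↾ W₂ Z Y) ++ [ (Z , t Z) ])
    fixesAllBut-W₂ {Y} {Z} {p} {t} Z≢Y p~t = record { agrees = agrees ; covers = covers ; avoids = avoids }
      where
      agrees : ∀ {V v} → (V , v) ∈ (p ↾ W₂ Z Y) ++ [ (Z , t Z) ] → v ≡ t V
      agrees V∈ with ∈-++⁻ (p ↾ W₂ Z Y) V∈
      ... | inj₂ (here refl) = refl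
      ... | inj₁ V∈↾ with V , V∈W₂ , refl ← ∈-map⁻ _ V∈↾ = p~t V (proj₁ (∈-W₂⁻ {X = Z} V∈W₂))
      covers : ∀ V → V ≢ Y → Σ[ v ∈ Val V ] (V , v) ∈ (p ↾ W₂ Z Y) ++ [ (Z , t Z) ]
      covers V V≢Y with V ≟ Z
      ... | yes refl = t Z , ∈-++⁺ʳ (p ↾ W₂ Z Y) (here refl)
      ... | no V≢Z = p V , ∈-++⁺ˡ (∈-map⁺ (λ V → V , p V) (∈-W₂⁺ V≢Z V≢Y))
      avoids : ∀ {V v} → (V , v) ∈ (p ↾ W₂ Z Y) ++ [ (Z , t Z) ] → V ≢ Y
      avoids V∈ with ∈-++⁻ (p ↾ W₂ Z Y) V∈
      ... | inj₂ (here refl) = Z≢Y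
      ... | inj₁ V∈↾ with V , V∈W₂ , refl ← ∈-map⁻ _ V∈↾ = proj₂ (∈-W₂⁻ {X = Z} V∈W₂)

    φEndᶜ-fails : ∀ {Y e T} → End M Y ≡ true → ¬ (M ∣ e ∷ T ⊨ (φEnd Y) ᶜ)
    φEndᶜ-fails {Y} endY ⊨ᶜ with direct-cause endY
    ... | Z , p , q , p~q , Fp≢Fq =
      ⋁ᶜ-fails (dcDisjuncts Z Y) (∈-dcDisjuncts pZ≢qZ Fp≢Fq (↾-∈-ranW (W₂ Z Y) p))
        (λ e → forced-value endY fixes-p [ e ] , forced-value endY fixes-q [ e ])
        [ forced-valueᶜ-fails endY fixes-p , forced-valueᶜ-fails endY fixes-q ]′
        (⨆ᶜ-elim _ (∈-map⁺ (λ X → φDC X Y) (∈-W₁⁺ Z≢Y)) ⊨ᶜ)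
      where
      Z≢Y : Z ≢ Y
      Z≢Y refl = Fp≢Fq (onlyWV Z endY p q p~q)
      pZ≢qZ : p Z ≢ q Z
      pZ≢qZ pZ≡qZ = Fp≢Fq (F-extensional endY p q (agree-everywhere p~q pZ≡qZ))
      fixes-p : FixesAllBut Y p ((p ↾ W₂ Z Y) ++ [ (Z , p Z) ])
      fixes-p = fixesAllBut-W₂ Z≢Y (λ _ _ → refl)
      fixes-q : FixesAllBut Y q ((p ↾ W₂ Z Y) ++ [ (Z , q Z) ])
      fixes-q = fixesAllBut-W₂ Z≢Y p~q

    C10-valid : ∀ {Y} (y : Val Y) {w} → w ∈ ranW (W₁ Y) → ∀ T →
                M ∣ T ⊨ ((φEnd Y) ᶜ ⇒ ((Y ≐ y) ⊃' (w □→ (Y ≐ y))))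
    C10-valid y w∈ [] _ .[] f[] = inj₂ λ { .[] [] → [] }
    C10-valid {Y} y {w} w∈ (e ∷ T) ⊨ᶜ _ filtered with End M Y in endY
    ... | true = ⊥-elim (φEndᶜ-fails endY ⊨ᶜ)
    ... | false = inj₂ λ _ intervened →
      exogenous-preserved endY Y∉w intervened (All.map (λ { (Y≡y ∷ []) → Y≡y }) (Filt⇒All filtered))
      where
      Y∉w : inI Y w ≡ false
      Y∉w = inI-∉ w (λ W∈w → ∈-W₁⁻ (ranW-vars (W₁ Y) w∈ W∈w))

mainTheorem12 : (σ : Signature) → let open Semantics σ in
    (T : CausalMultiteam) (Y : Var) (y : Val Y) (w : Interv) → w ∈ ranW (W₁ Y) →
    T ⊨ ((φEnd Y) ᶜ ⇒ ((Y ≐ y) ⊃' (w □→ (Y ≐ y))))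
mainTheorem12 σ T Y y w w∈ = CausalModel.C10-valid σ T y w∈ _
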